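{- Let $(f,C)$ be a low-defect pair of degree $r$. Then the function $\delta_{f,C}:\mathbb{Z}_{\ge0}^r\to\mathbb{R}$ is strictly increasing in each variable, and \[ \delta(f,C)=\sup_{k_1,\ldots,k_r\ge0}\delta_{f,C}(k_1,\ldots,k_r). \]
   Context: $\|n\|$ is the least number of $1$'s needed to write $n\in\mathbb{N}$ using $1$, $+$, $\times$, parentheses. Low-defect pairs form the smallest subset of $\mathbb{Z}[x_1,x_2,\ldots]\times\mathbb{N}$ such that: (i) $(k,C)$ is one for any constant $k\in\mathbb{N}$ and $C\ge\|k\|$; (ii) if $(f_1,C_1),(f_2,C_2)$ are ones, then so is $(f_1\otimes f_2,C_1+C_2)$, where $f_1\otimes f_2$ is the product of $f_1$ and $f_2$ after relabeling variables so they share none; (iii) if $(f,C)$ is one, $c\in\mathbb{N}$ and $D\ge\|c\|$, then $(f\cdot y+c,C+D)$ is one, where $y$ is a new variable not in $f$. If $f$ has degree $r$, it is a multilinear polynomial in $x_1,\ldots,x_r$ with nonnegative integer coefficients, nonzero constant term, and nonzero leading coefficient $a$ (the coefficient of $x_1\cdots x_r$). $\delta(f,C)=C-3\log_3 a$ and $\delta_{f,C}(k_1,\ldots,k_r)=C+3(k_1+\cdots+k_r)-3\log_3 f(3^{k_1},\ldots,3^{k_r})$. -}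

module Defs where

open import Data.Nat using (ℕ; zero; suc; _+_; _*_; _^_; _≤_; _<_)
open import Data.Bool using (Bool; true; false; if_then_else_)
open import Data.Vec using (Vec; []; _∷_; take; drop; replicate; map; lookup; _[_]≔_; foldr)
open import Data.Fin using (Fin)
open import Data.List using (List; concatMap) renaming ([] to []ᴸ; _∷_ to _∷ᴸ_; map to mapᴸ)
open import Data.Nat.ListAction using () renaming (sum to sumᴸ)
open import Data.Product using (Σ; _×_; _,_)
open import Relation.Binary.PropositionalEquality using (_≡_)

-- Integer complexity ‖n‖: least number of 1's in an expression built
-- from 1, +, × (with parentheses = expression trees).

data Expr : Set where
  one   : Expr
  _⊕_   : Expr → Expr → Expr
  _⊗ₑ_  : Expr → Expr → Expr

value : Expr → ℕ
value one        = 1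
value (e ⊕ e′)   = value e + value e′
value (e ⊗ₑ e′)  = value e * value e′

ones : Expr → ℕ
ones one        = 1
ones (e ⊕ e′)   = ones e + ones e′
ones (e ⊗ₑ e′)  = ones e + ones e′

-- "C ≥ ‖n‖": n has an expression using at most C ones.
-- (Since ‖n‖ is the minimum, this is exactly ‖n‖ ≤ C; it forces n ≥ 1.)
ComplexityAtMost : ℕ → ℕ → Set
ComplexityAtMost n C = Σ Expr (λ e → value e ≡ n × ones e ≤ C)

-- Multilinear polynomials in r variables with coefficients in ℕ,
-- given by their coefficient function: a monomial is a subset of the
-- variables, encoded as a Vec Bool r (true = variable occurs).

Poly : ℕ → Set
Poly r = Vec Bool r → ℕ

monomials : (r : ℕ) → List (Vec Bool r)
monomials zero    = [] ∷ᴸ []ᴸ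
monomials (suc r) = concatMap (λ v → (false ∷ v) ∷ᴸ (true ∷ v) ∷ᴸ []ᴸ) (monomials r)

allFalse : ∀ {r} → Vec Bool r → Bool
allFalse []          = true
allFalse (true ∷ v)  = false
allFalse (false ∷ v) = allFalse v

monoVal : ∀ {r} → Vec Bool r → Vec ℕ r → ℕ
monoVal []          []       = 1
monoVal (true ∷ s)  (x ∷ xs) = x * monoVal s xs
monoVal (false ∷ s) (x ∷ xs) = monoVal s xs

eval : ∀ {r} → Poly r → Vec ℕ r → ℕ
eval {r} f xs = sumᴸ (mapᴸ (λ s → f s * monoVal s xs) (monomials r))

lead : ∀ {r} → Poly r → ℕ
lead {r} f = f (replicate r true)

constP : ℕ → Poly 0
constP k _ = k

tensor : ∀ {r₁ r₂} → Poly r₁ → Poly r₂ → Poly (r₁ + r₂)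
tensor {r₁} f g s = f (take r₁ s) * g (drop r₁ s)

-- f·y + c, the new variable y placed first
augment : ∀ {r} → Poly r → ℕ → Poly (suc r)
augment f c (true ∷ s)  = f s
augment f c (false ∷ s) = if allFalse s then c else 0

data LowDefect : (r : ℕ) → Poly r → ℕ → Set where
  ld-const  : (k C : ℕ) → ComplexityAtMost k C → LowDefect 0 (constP k) C
  ld-tensor : ∀ {r₁ r₂ f₁ f₂ C₁ C₂} → LowDefect r₁ f₁ C₁ → LowDefect r₂ f₂ C₂ →
              LowDefect (r₁ + r₂) (tensor f₁ f₂) (C₁ + C₂)
  ld-aug    : ∀ {r f C} → LowDefect r f C → (c D : ℕ) → ComplexityAtMost c D →
              LowDefect (suc r) (augment f c) (C + D)

-- Defects, encoded exactly in ℕ (no reals in the library).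
-- δ_{f,C}(k) = C + 3Σk − 3 log₃ f(3^{k₁},…,3^{k_r}),  δ(f,C) = C − 3 log₃ a.

sumV : ∀ {r} → Vec ℕ r → ℕ
sumV = foldr _ _+_ 0

pow3 : ∀ {r} → Vec ℕ r → Vec ℕ r
pow3 = map (3 ^_)

evalAt3 : ∀ {r} → Poly r → Vec ℕ r → ℕ
evalAt3 f k = eval f (pow3 k)

-- δ_{f,C}(k) < δ_{f,C}(k′)  ⇔  3^{Σk} · f(3^{k′}) < 3^{Σk′} · f(3^{k})
δ-lt : ∀ {r} → Poly r → Vec ℕ r → Vec ℕ r → Set
δ-lt f k k′ = 3 ^ sumV k * evalAt3 f k′ < 3 ^ sumV k′ * evalAt3 f k

-- δ_{f,C}(k) ≤ δ(f,C)  ⇔  a · 3^{Σk} ≤ f(3^{k})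
δ-le-defect : ∀ {r} → Poly r → Vec ℕ r → Set
δ-le-defect f k = lead f * 3 ^ sumV k ≤ evalAt3 f k

-- δ_{f,C}(k) > δ(f,C) − ε for ε = 3 log₃(1 + 1/n), i.e.
-- n · f(3^{k}) < (n+1) · a · 3^{Σk}.  (ε ranges over a set of positive
-- reals tending to 0, so "for all n" is equivalent to "for all ε > 0".)
δ-close : ∀ {r} → Poly r → ℕ → Vec ℕ r → Set
δ-close f n k = n * evalAt3 f k < suc n * (lead f * 3 ^ sumV k)

bump : ∀ {r} → Vec ℕ r → Fin r → ℕ → Vec ℕ r
bump k i d = k [ i ]≔ (lookup k i + suc d)

-- Apart from positivity, everything holds for any multilinear f with coefficients in ℕ, by
-- induction on the number of variables through f = coeff₀ f + x₁ · coeff₁ f.  Multiplying one variable by m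
-- multiplies each monomial by m or by 1, so f grows by a factor at most m, and strictly less as
-- soon as a monomial without that variable (the constant term) is nonzero: this is the strict
-- monotonicity of δ_{f,C}.  Every monomial is at most f, in particular a·x₁⋯x_r, which is
-- δ_{f,C} ≤ δ(f,C).  On the diagonal, f(x,…,x) ≤ a xʳ + f(1,…,1) xʳ⁻¹, so at x = 3^K with K large
-- δ_{f,C} comes arbitrarily close to δ(f,C).  Low-defect pairs only contribute a > 0 and
-- f(0,…,0) > 0, both of which are preserved by ⊗ and by f·y + c.
module Submission where

open import Defs
open import Data.Nat using (ℕ; zero; suc; _+_; _*_; _^_; _≤_; _<_; z≤n; s≤s; z<s; NonZero; >-nonZero)
open import Data.Nat.Properties
open import Data.Bool using (Bool; true; false)
open import Data.Vec using (Vec; []; _∷_; replicate; take; drop; lookup; _[_]≔_)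
open import Data.Vec.Properties using (map-[]≔; map-replicate; lookup-map)
open import Data.List using (List; concatMap) renaming ([] to []ᴸ; _∷_ to _∷ᴸ_; map to mapᴸ)
open import Data.Nat.ListAction using () renaming (sum to sumᴸ)
open import Data.Fin using (Fin; zero; suc)
open import Data.Product using (Σ; _×_; _,_)
open import Relation.Binary.PropositionalEquality
open import Data.Nat.Tactic.RingSolver using (solve-∀)
open import Algebra.Properties.CommutativeSemigroup +-commutativeSemigroup using (xy∙z≈xz∙y)

constTerm : ∀ {r} → Poly r → ℕ
constTerm {r} f = f (replicate r false)

coeff₀ coeff₁ : ∀ {r} → Poly (suc r) → Poly r
coeff₀ f s = f (false ∷ s)
coeff₁ f s = f (true ∷ s)

eval-∷ : ∀ {r} (f : Poly (suc r)) x (xs : Vec ℕ r) →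
  eval f (x ∷ xs) ≡ eval (coeff₀ f) xs + x * eval (coeff₁ f) xs
eval-∷ {r} f x xs = sum-branches (monomials r)
  where
  term : ∀ {n} → Poly n → Vec ℕ n → Vec Bool n → ℕ
  term g ys s = g s * monoVal s ys
  sum-branches : (L : List (Vec Bool r)) →
    sumᴸ (mapᴸ (term f (x ∷ xs)) (concatMap (λ v → (false ∷ v) ∷ᴸ (true ∷ v) ∷ᴸ []ᴸ) L))
      ≡ sumᴸ (mapᴸ (term (coeff₀ f) xs) L) + x * sumᴸ (mapᴸ (term (coeff₁ f) xs) L)
  sum-branches []ᴸ = sym (*-zeroʳ x)
  sum-branches (v ∷ᴸ L) rewrite sum-branches L =
    regroup (coeff₀ f v) (coeff₁ f v) (monoVal v xs) x _ _
    where
    regroup : ∀ a b m x A B → a * m + (b * (x * m) + (A + x * B)) ≡ a * m + A + x * (b * m + B)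
    regroup = solve-∀

term≤eval : ∀ {r} (f : Poly r) (s : Vec Bool r) (xs : Vec ℕ r) → f s * monoVal s xs ≤ eval f xs
term≤eval f []          []       = m≤m+n _ 0
term≤eval f (false ∷ s) (x ∷ xs) rewrite eval-∷ f x xs =
  ≤-trans (term≤eval (coeff₀ f) s xs) (m≤m+n _ _)
term≤eval f (true ∷ s)  (x ∷ xs) rewrite eval-∷ f x xs = begin
  f (true ∷ s) * (x * monoVal s xs)          ≡⟨ x*-comm (f (true ∷ s)) x (monoVal s xs) ⟩
  x * (coeff₁ f s * monoVal s xs)             ≤⟨ *-monoʳ-≤ x (term≤eval (coeff₁ f) s xs) ⟩
  x * eval (coeff₁ f) xs                      ≤⟨ m≤n+m _ _ ⟩
  eval (coeff₀ f) xs + x * eval (coeff₁ f) xs ∎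
  where
  open ≤-Reasoning
  x*-comm : ∀ a x m → a * (x * m) ≡ x * (a * m)
  x*-comm = solve-∀

monoVal-replicate-false : ∀ {r} (xs : Vec ℕ r) → monoVal (replicate r false) xs ≡ 1
monoVal-replicate-false []       = refl
monoVal-replicate-false (x ∷ xs) = monoVal-replicate-false xs

constTerm≤eval : ∀ {r} (f : Poly r) (xs : Vec ℕ r) → constTerm f ≤ eval f xs
constTerm≤eval {r} f xs = begin
  constTerm f                                            ≡⟨ *-identityʳ _ ⟨
  constTerm f * 1                                        ≡⟨ cong (constTerm f *_) (monoVal-replicate-false xs) ⟨
  f (replicate r false) * monoVal (replicate r false) xs ≤⟨ term≤eval f _ xs ⟩
  eval f xs                                              ∎
  where open ≤-Reasoning

private
  scale-distrib : ∀ m A x B → m * A + x * (m * B) ≡ m * (A + x * B)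
  scale-distrib = solve-∀

eval-scale-≤ : ∀ {r} (f : Poly r) (xs : Vec ℕ r) (i : Fin r) m .{{_ : NonZero m}} →
  eval f (xs [ i ]≔ m * lookup xs i) ≤ m * eval f xs
eval-scale-≤ f (x ∷ xs) zero m rewrite eval-∷ f (m * x) xs | eval-∷ f x xs = begin
  A + m * x * B       ≡⟨ cong (A +_) (*-assoc m x B) ⟩
  A + m * (x * B)     ≤⟨ +-monoˡ-≤ _ (m≤n*m A m) ⟩
  m * A + m * (x * B) ≡⟨ *-distribˡ-+ m A (x * B) ⟨
  m * (A + x * B)     ∎
  where
  open ≤-Reasoning
  A = eval (coeff₀ f) xs
  B = eval (coeff₁ f) xs
eval-scale-≤ f (x ∷ xs) (suc i) m rewrite eval-∷ f x (xs [ i ]≔ m * lookup xs i) | eval-∷ f x xs = begin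
  eval (coeff₀ f) (xs [ i ]≔ m * lookup xs i) + x * eval (coeff₁ f) (xs [ i ]≔ m * lookup xs i)
    ≤⟨ +-mono-≤ (eval-scale-≤ (coeff₀ f) xs i m) (*-monoʳ-≤ x (eval-scale-≤ (coeff₁ f) xs i m)) ⟩
  m * eval (coeff₀ f) xs + x * (m * eval (coeff₁ f) xs)
    ≡⟨ scale-distrib m _ x _ ⟩
  m * (eval (coeff₀ f) xs + x * eval (coeff₁ f) xs) ∎
  where open ≤-Reasoning

eval-scale-< : ∀ {r} (f : Poly r) (xs : Vec ℕ r) (i : Fin r) m → 1 < m → 0 < constTerm f →
  eval f (xs [ i ]≔ m * lookup xs i) < m * eval f xs
eval-scale-< f (x ∷ xs) zero m 1<m 0<c rewrite eval-∷ f (m * x) xs | eval-∷ f x xs = begin-strict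
  A + m * x * B       ≡⟨ cong (A +_) (*-assoc m x B) ⟩
  A + m * (x * B)     <⟨ +-monoˡ-< _ A<m*A ⟩
  m * A + m * (x * B) ≡⟨ *-distribˡ-+ m A (x * B) ⟨
  m * (A + x * B)     ∎
  where
  open ≤-Reasoning
  A = eval (coeff₀ f) xs
  B = eval (coeff₁ f) xs
  A<m*A : A < m * A
  A<m*A = subst (A <_) (*-comm A m) (m<m*n A m {{>-nonZero (≤-trans 0<c (constTerm≤eval (coeff₀ f) xs))}} 1<m)
eval-scale-< f (x ∷ xs) (suc i) m 1<m 0<c
  rewrite eval-∷ f x (xs [ i ]≔ m * lookup xs i) | eval-∷ f x xs = begin-strict
  eval (coeff₀ f) (xs [ i ]≔ m * lookup xs i) + x * eval (coeff₁ f) (xs [ i ]≔ m * lookup xs i)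
    <⟨ +-mono-<-≤ (eval-scale-< (coeff₀ f) xs i m 1<m 0<c)
                  (*-monoʳ-≤ x (eval-scale-≤ (coeff₁ f) xs i m {{>-nonZero (<-trans z<s 1<m)}})) ⟩
  m * eval (coeff₀ f) xs + x * (m * eval (coeff₁ f) xs)
    ≡⟨ scale-distrib m _ x _ ⟩
  m * (eval (coeff₀ f) xs + x * eval (coeff₁ f) xs) ∎
  where open ≤-Reasoning

eval-replicate-≤ : ∀ {r} (f : Poly r) x .{{_ : NonZero x}} →
  eval f (replicate r x) ≤ eval f (replicate r 1) * x ^ r
eval-replicate-≤ {zero}  f x = m≤m*n _ 1
eval-replicate-≤ {suc r} f x rewrite eval-∷ f x (replicate r x) | eval-∷ f 1 (replicate r 1) = begin
  A + x * B                   ≤⟨ +-mono-≤ (eval-replicate-≤ (coeff₀ f) x)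
                                          (*-monoʳ-≤ x (eval-replicate-≤ (coeff₁ f) x)) ⟩
  A₁ * X + x * (B₁ * X)       ≤⟨ +-monoˡ-≤ _ (m≤n*m (A₁ * X) x) ⟩
  x * (A₁ * X) + x * (B₁ * X) ≡⟨ regroup x A₁ B₁ X ⟩
  (A₁ + 1 * B₁) * (x * X)     ∎
  where
  open ≤-Reasoning
  A = eval (coeff₀ f) (replicate r x)
  B = eval (coeff₁ f) (replicate r x)
  A₁ = eval (coeff₀ f) (replicate r 1)
  B₁ = eval (coeff₁ f) (replicate r 1)
  X = x ^ r
  regroup : ∀ x A B X → x * (A * X) + x * (B * X) ≡ (A + 1 * B) * (x * X)
  regroup = solve-∀

-- Every monomial other than x₁⋯x_r has degree < r; the extra factor x pays for that.
*-eval-replicate-≤ : ∀ {r} (f : Poly r) x .{{_ : NonZero x}} →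
  x * eval f (replicate r x) ≤ (x * lead f + eval f (replicate r 1)) * x ^ r
*-eval-replicate-≤ {zero}  f x = begin
  x * (f [] * 1 + 0)              ≡⟨ regroup x (f []) ⟨
  x * f [] * 1                    ≤⟨ *-monoˡ-≤ 1 (m≤m+n (x * f []) _) ⟩
  (x * f [] + (f [] * 1 + 0)) * 1 ∎
  where
  open ≤-Reasoning
  regroup : ∀ x a → x * a * 1 ≡ x * (a * 1 + 0)
  regroup = solve-∀
*-eval-replicate-≤ {suc r} f x rewrite eval-∷ f x (replicate r x) | eval-∷ f 1 (replicate r 1) = begin
  x * (A + x * B)                       ≡⟨ *-distribˡ-+ x A (x * B) ⟩
  x * A + x * (x * B)                   ≤⟨ +-mono-≤ (*-monoʳ-≤ x (eval-replicate-≤ (coeff₀ f) x))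
                                                    (*-monoʳ-≤ x (*-eval-replicate-≤ (coeff₁ f) x)) ⟩
  x * (A₁ * X) + x * ((x * a + B₁) * X) ≡⟨ regroup x a A₁ B₁ X ⟩
  (x * a + (A₁ + 1 * B₁)) * (x * X)     ∎
  where
  open ≤-Reasoning
  a = lead f
  A = eval (coeff₀ f) (replicate r x)
  B = eval (coeff₁ f) (replicate r x)
  A₁ = eval (coeff₀ f) (replicate r 1)
  B₁ = eval (coeff₁ f) (replicate r 1)
  X = x ^ r
  regroup : ∀ x a A B X → x * (A * X) + x * ((x * a + B) * X) ≡ (x * a + (A + 1 * B)) * (x * X)
  regroup = solve-∀

eval-replicate-close : ∀ {r} (f : Poly r) n x → 0 < lead f → n * eval f (replicate r 1) < x →
  n * eval f (replicate r x) < suc n * (lead f * x ^ r)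
eval-replicate-close {r} f n x 0<a nB<x = *-cancelˡ-< x _ _ (begin-strict
  x * (n * P)                     ≡⟨ x*-comm x n P ⟩
  n * (x * P)                     ≤⟨ *-monoʳ-≤ n (*-eval-replicate-≤ f x) ⟩
  n * ((x * a + B) * X)           ≡⟨ regroup x n a B X ⟩
  x * (n * (a * X)) + n * B * X   <⟨ +-monoʳ-< _ (*-monoˡ-< X {{m^n≢0 x r}} nB<x) ⟩
  x * (n * (a * X)) + x * X       ≤⟨ +-monoʳ-≤ _ (*-monoʳ-≤ x (m≤n*m X a {{>-nonZero 0<a}})) ⟩
  x * (n * (a * X)) + x * (a * X) ≡⟨ x*-suc x n (a * X) ⟩
  x * (suc n * (a * X))           ∎)
  where
  instance
    x≢0 : NonZero x
    x≢0 = >-nonZero (≤-trans (s≤s z≤n) nB<x)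
  open ≤-Reasoning
  a = lead f
  B = eval f (replicate r 1)
  P = eval f (replicate r x)
  X = x ^ r
  x*-comm : ∀ x n P → x * (n * P) ≡ n * (x * P)
  x*-comm = solve-∀
  regroup : ∀ x n a B X → n * ((x * a + B) * X) ≡ x * (n * (a * X)) + n * B * X
  regroup = solve-∀
  x*-suc : ∀ x n Y → x * (n * Y) + x * Y ≡ x * (suc n * Y)
  x*-suc = solve-∀

monoVal-replicate-true-pow3 : ∀ {r} (k : Vec ℕ r) → monoVal (replicate r true) (pow3 k) ≡ 3 ^ sumV k
monoVal-replicate-true-pow3 []      = refl
monoVal-replicate-true-pow3 (x ∷ k) =
  trans (cong (3 ^ x *_) (monoVal-replicate-true-pow3 k)) (sym (^-distribˡ-+-* 3 x (sumV k)))

3^sumV-replicate : ∀ r K → 3 ^ sumV (replicate r K) ≡ (3 ^ K) ^ r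
3^sumV-replicate zero    K = refl
3^sumV-replicate (suc r) K =
  trans (^-distribˡ-+-* 3 K (sumV (replicate r K))) (cong (3 ^ K *_) (3^sumV-replicate r K))

sumV-bump : ∀ {r} (k : Vec ℕ r) i d → sumV (bump k i d) ≡ sumV k + suc d
sumV-bump (x ∷ k) zero    d = xy∙z≈xz∙y x (suc d) (sumV k)
sumV-bump (x ∷ k) (suc i) d = trans (cong (x +_) (sumV-bump k i d)) (sym (+-assoc x (sumV k) (suc d)))

pow3-bump : ∀ {r} (k : Vec ℕ r) i d → pow3 (bump k i d) ≡ pow3 k [ i ]≔ 3 ^ suc d * lookup (pow3 k) i
pow3-bump k i d = trans (map-[]≔ (3 ^_) k i) (cong (pow3 k [ i ]≔_) (begin
  3 ^ (lookup k i + suc d)         ≡⟨ ^-distribˡ-+-* 3 (lookup k i) (suc d) ⟩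
  3 ^ lookup k i * 3 ^ suc d       ≡⟨ *-comm (3 ^ lookup k i) (3 ^ suc d) ⟩
  3 ^ suc d * 3 ^ lookup k i       ≡⟨ cong (3 ^ suc d *_) (lookup-map i (3 ^_) k) ⟨
  3 ^ suc d * lookup (pow3 k) i    ∎))
  where open ≡-Reasoning

n<3^n : ∀ n → n < 3 ^ n
n<3^n zero    = s≤s z≤n
n<3^n (suc n) = ≤-trans (+-mono-≤ (m^n>0 3 n) (n<3^n n)) (+-monoʳ-≤ (3 ^ n) (m≤m+n (3 ^ n) _))

δ-lt-bump : ∀ {r} (f : Poly r) → 0 < constTerm f → (k : Vec ℕ r) (i : Fin r) (d : ℕ) → δ-lt f k (bump k i d)
δ-lt-bump f 0<c k i d = begin-strict
  3 ^ S * evalAt3 f (bump k i d)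
    ≡⟨ cong (λ ys → 3 ^ S * eval f ys) (pow3-bump k i d) ⟩
  3 ^ S * eval f (pow3 k [ i ]≔ 3 ^ suc d * lookup (pow3 k) i)
    <⟨ *-monoʳ-< (3 ^ S) {{m^n≢0 3 S}} (eval-scale-< f (pow3 k) i (3 ^ suc d) 1<3^[1+d] 0<c) ⟩
  3 ^ S * (3 ^ suc d * evalAt3 f k)
    ≡⟨ *-assoc (3 ^ S) (3 ^ suc d) _ ⟨
  3 ^ S * 3 ^ suc d * evalAt3 f k
    ≡⟨ cong (_* evalAt3 f k) (^-distribˡ-+-* 3 S (suc d)) ⟨
  3 ^ (S + suc d) * evalAt3 f k
    ≡⟨ cong (λ e → 3 ^ e * evalAt3 f k) (sumV-bump k i d) ⟨
  3 ^ sumV (bump k i d) * evalAt3 f k ∎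
  where
  open ≤-Reasoning
  S = sumV k
  1<3^[1+d] : 1 < 3 ^ suc d
  1<3^[1+d] = ^-monoʳ-< 3 (s≤s (s≤s z≤n)) {0} {suc d} z<s

δ-le-defect-always : ∀ {r} (f : Poly r) (k : Vec ℕ r) → δ-le-defect f k
δ-le-defect-always {r} f k =
  subst (λ t → lead f * t ≤ evalAt3 f k) (monoVal-replicate-true-pow3 k) (term≤eval f (replicate r true) (pow3 k))

δ-close-replicate : ∀ {r} (f : Poly r) → 0 < lead f → ∀ n K → n * eval f (replicate r 1) < 3 ^ K →
  δ-close f n (replicate r K)
δ-close-replicate {r} f 0<a n K large rewrite map-replicate (3 ^_) K r | 3^sumV-replicate r K =
  eval-replicate-close f n (3 ^ K) 0<a large

complexity⇒>0 : ∀ {n C} → ComplexityAtMost n C → 0 < n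
complexity⇒>0 (e , refl , _) = value>0 e
  where
  value>0 : ∀ e → 0 < value e
  value>0 one       = s≤s z≤n
  value>0 (e ⊕ e′)  = ≤-trans (value>0 e) (m≤m+n _ _)
  value>0 (e ⊗ₑ e′) = *-mono-≤ (value>0 e) (value>0 e′)

take-replicate : ∀ {A : Set} m {n} (x : A) → take m (replicate (m + n) x) ≡ replicate m x
take-replicate zero    x = refl
take-replicate (suc m) x = cong (x ∷_) (take-replicate m x)

drop-replicate : ∀ {A : Set} m {n} (x : A) → drop m (replicate (m + n) x) ≡ replicate n x
drop-replicate zero    x = refl
drop-replicate (suc m) x = drop-replicate m x

tensor-replicate : ∀ {r₁ r₂} (f : Poly r₁) (g : Poly r₂) b →
  tensor f g (replicate (r₁ + r₂) b) ≡ f (replicate r₁ b) * g (replicate r₂ b)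
tensor-replicate {r₁} f g b = cong₂ (λ u v → f u * g v) (take-replicate r₁ b) (drop-replicate r₁ b)

allFalse-replicate : ∀ r → allFalse (replicate r false) ≡ true
allFalse-replicate zero    = refl
allFalse-replicate (suc r) = allFalse-replicate r

lowDefect⇒lead>0 : ∀ {r f C} → LowDefect r f C → 0 < lead f
lowDefect⇒lead>0 (ld-const k C cx) = complexity⇒>0 cx
lowDefect⇒lead>0 (ld-tensor {f₁ = f₁} {f₂} d₁ d₂) =
  subst (0 <_) (sym (tensor-replicate f₁ f₂ true)) (*-mono-≤ (lowDefect⇒lead>0 d₁) (lowDefect⇒lead>0 d₂))
lowDefect⇒lead>0 (ld-aug d c D cx) = lowDefect⇒lead>0 d

lowDefect⇒constTerm>0 : ∀ {r f C} → LowDefect r f C → 0 < constTerm f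
lowDefect⇒constTerm>0 (ld-const k C cx) = complexity⇒>0 cx
lowDefect⇒constTerm>0 (ld-tensor {f₁ = f₁} {f₂} d₁ d₂) =
  subst (0 <_) (sym (tensor-replicate f₁ f₂ false)) (*-mono-≤ (lowDefect⇒constTerm>0 d₁) (lowDefect⇒constTerm>0 d₂))
lowDefect⇒constTerm>0 {suc r} (ld-aug d c D cx) rewrite allFalse-replicate r = complexity⇒>0 cx

proposition2p14 : ∀ {r C} {f : Poly r} → LowDefect r f C →
    ((k : Vec ℕ r) (i : Fin r) (d : ℕ) → δ-lt f k (bump k i d))
    × ((k : Vec ℕ r) → δ-le-defect f k)
    × ((n : ℕ) → Σ (Vec ℕ r) (λ k → δ-close f n k))
proposition2p14 {r} {f = f} ld =
    δ-lt-bump f (lowDefect⇒constTerm>0 ld)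
  , δ-le-defect-always f
  , λ n → let K = n * eval f (replicate r 1) in
          replicate r K , δ-close-replicate f (lowDefect⇒lead>0 ld) n K (n<3^n K)
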